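{- Let $V_n$, $n\ge0$, be the approximating graphs of the non-p.c.f. analog of the Sierpiński gasket (defined in the context). Then $V_n$ has $\frac{4\cdot6^n+11}{5}$ vertices, and its vertex set is the disjoint union of: (i) a set of $3$ vertices each of degree $2^{n+1}$; (ii) for each $1\le k\le n$, a set of $6^{k-1}$ vertices each of degree $3\cdot2^{n-k+2}$; (iii) for each $1\le k\le n$, a set of $3\cdot6^{k-1}$ vertices each of degree $2^{n-k+2}$.
   Context: The graphs $V_n$ are multigraphs (edges counted with multiplicity, degrees counted accordingly), each being a union of $6^n$ "cells", a cell being a triangle (three vertices with the three edges between them). $V_0$ is a single cell on vertices $x_1,x_2,x_3$. For $n\ge1$, $V_n$ is obtained from $V_{n-1}$ by replacing every cell with vertices $a,b,c$ by its barycentric subdivision: introduce four new vertices $u_{ab},u_{bc},u_{ca},o$ (new vertices introduced for different cells are distinct) and replace the cell by the six cells $\{a,u_{ab},o\},\{u_{ab},b,o\},\{b,u_{bc},o\},\{u_{bc},c,o\},\{c,u_{ca},o\},\{u_{ca},a,o\}$; the edge multiset of $V_n$ is the union (with multiplicity) of the edges of all its cells. -}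

module Defs where

open import Data.Nat using (ℕ; zero; suc; _+_; _*_; _∸_; _^_; _≟_)
open import Data.Nat.DivMod using (_/_)
open import Data.Fin using (Fin; toℕ)
import Data.Fin as F
open import Data.List using (List; []; _∷_; _++_; length; map; concatMap; filter; allFin)
open import Data.Nat.ListAction using (sum)
open import Data.Product using (_×_; _,_)
open import Relation.Nullary using (Dec; yes; no)
open import Relation.Binary.PropositionalEquality using (_≡_; refl; cong)

-- Vertices are labelled by natural numbers; a graph with nV vertices has
-- vertex set {0, …, nV-1}.  A cell is an (ordered) triple of vertices.
Cell : Set
Cell = ℕ × ℕ × ℕ

record Gr : Set where
  constructor mkGr
  field
    nV    : ℕ
    cells : List Cell
open Gr public

-- barycentric subdivision of one cell a b c, using fresh labels
-- u_ab = base, u_bc = base+1, u_ca = base+2, o = base+3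
subdivCell : ℕ → Cell → List Cell
subdivCell base (a , b , c) =
  (a , uab , o) ∷ (uab , b , o) ∷ (b , ubc , o) ∷ (ubc , c , o)
    ∷ (c , uca , o) ∷ (uca , a , o) ∷ []
  where
  uab = base
  ubc = base + 1
  uca = base + 2
  o   = base + 3

subdivAll : ℕ → List Cell → List Cell
subdivAll base []       = []
subdivAll base (t ∷ ts) = subdivCell base t ++ subdivAll (base + 4) ts

step : Gr → Gr
step (mkGr N cs) = mkGr (N + 4 * length cs) (subdivAll N cs)

-- the approximating graphs V_n ; V_0 is the single cell on x1=0, x2=1, x3=2
V : ℕ → Gr
V zero    = mkGr 3 ((0 , 1 , 2) ∷ [])
V (suc n) = step (V n)

-- edge multiset: union with multiplicity of the three edges of each cell
cellEdges : Cell → List (ℕ × ℕ)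
cellEdges (a , b , c) = (a , b) ∷ (b , c) ∷ (c , a) ∷ []

edges : Gr → List (ℕ × ℕ)
edges G = concatMap cellEdges (cells G)

ind : ∀ {m n : ℕ} → Dec (m ≡ n) → ℕ
ind (yes _) = 1
ind (no _)  = 0

degree : Gr → ℕ → ℕ
degree G v = sum (map (λ { (x , y) → ind (x ≟ v) + ind (y ≟ v) }) (edges G))

-- the vertex classes of V_n: (i) corner; (ii) centre k; (iii) mid k,
-- where k = toℕ i + 1 ranges over 1 … n for i : Fin n
data VClass (n : ℕ) : Set where
  corner : VClass n
  centre : Fin n → VClass n
  mid    : Fin n → VClass n

_≟C_ : ∀ {n} (c d : VClass n) → Dec (c ≡ d)
corner   ≟C corner   = yes refl
corner   ≟C centre _ = no λ ()
corner   ≟C mid _    = no λ ()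
centre _ ≟C corner   = no λ ()
centre i ≟C centre j with i F.≟ j
... | yes refl = yes refl
... | no ne    = no λ { refl → ne refl }
centre _ ≟C mid _    = no λ ()
mid _    ≟C corner   = no λ ()
mid _    ≟C centre _ = no λ ()
mid i    ≟C mid j with i F.≟ j
... | yes refl = yes refl
... | no ne    = no λ { refl → ne refl }

classSize : (n : ℕ) → VClass n → ℕ
classSize n corner     = 3
classSize n (centre i) = 6 ^ (suc (toℕ i) ∸ 1)
classSize n (mid i)    = 3 * 6 ^ (suc (toℕ i) ∸ 1)

classDeg : (n : ℕ) → VClass n → ℕ
classDeg n corner     = 2 ^ (n + 1)
classDeg n (centre i) = 3 * 2 ^ (n ∸ suc (toℕ i) + 2)
classDeg n (mid i)    = 2 ^ (n ∸ suc (toℕ i) + 2)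

classCount : ∀ {n} (G : Gr) → (Fin (nV G) → VClass n) → VClass n → ℕ
classCount G cls c = length (filter (λ v → cls v ≟C c) (allFin (nV G)))

module Submission where

-- The degree of v is the sum over cells of its degree inside a cell (2 per
-- corner equal to v).  Subdividing a cell a b c doubles the degrees of a, b, c
-- and gives u_ab, u_bc, u_ca degree 4 and the centre o degree 12.  So in
-- V_{n+1} old vertices have twice their degree in V_n, and a fresh vertex
-- has degree 4 or 12 according to its position in its block of four labels.
-- Old vertices keep their class; the fresh centres of the step n → n+1 form
-- class (ii) with k = n+1, the fresh edge points class (iii).  Each of the
-- 6^n cells of V_n contributes one centre and three edge points, giving the
-- class sizes and 5 · nV (V n) = 4 · 6^n + 11.

open import Defs
open import Data.Nat using (ℕ; zero; suc; _+_; _*_; _^_; _∸_; _≤_; _<_; _≟_; _<?_; s≤s; z<s; s<s)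
open import Data.Nat.DivMod using (_/_; m*n/n≡m)
open import Data.Nat.Properties
open import Data.Nat.Tactic.RingSolver using (solve-∀)
open import Data.Bool using (Bool; true; false; if_then_else_)
open import Data.Fin using (Fin; toℕ; fromℕ; inject₁)
import Data.Fin as F
open import Data.Fin.Properties using (toℕ-inject₁; toℕ-fromℕ; toℕ<n; fromℕ≢inject₁; inject₁-injective)
open import Data.List using (List; []; _∷_; _++_; length; filter; tabulate)
open import Data.Product using (Σ; _×_; _,_; proj₁; proj₂)
open import Data.Sum using (_⊎_; inj₁; inj₂)
open import Data.Empty using (⊥-elim)
open import Function using (_∘_)
open import Relation.Nullary using (Dec; yes; no; ¬_)
open import Relation.Binary.PropositionalEquality
  using (_≡_; _≢_; refl; sym; trans; cong; cong₂; subst; module ≡-Reasoning)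

open ≡-Reasoning

𝟙 : {A : Set} → Dec A → ℕ
𝟙 (yes _) = 1
𝟙 (no _)  = 0

𝟙-yes : {A : Set} (d : Dec A) → A → 𝟙 d ≡ 1
𝟙-yes (yes _) _ = refl
𝟙-yes (no ¬a) a = ⊥-elim (¬a a)

𝟙-no : {A : Set} (d : Dec A) → ¬ A → 𝟙 d ≡ 0
𝟙-no (yes a) ¬a = ⊥-elim (¬a a)
𝟙-no (no _)  _  = refl

𝟙-⇔ : {A B : Set} (p : Dec A) (q : Dec B) → (A → B) → (B → A) → 𝟙 p ≡ 𝟙 q
𝟙-⇔ (yes a) q f _ = sym (𝟙-yes q (f a))
𝟙-⇔ (no ¬a) q _ g = sym (𝟙-no q (¬a ∘ g))

ind≡𝟙 : {m n : ℕ} (d : Dec (m ≡ n)) → ind d ≡ 𝟙 d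
ind≡𝟙 (yes _) = refl
ind≡𝟙 (no _)  = refl

incid : ℕ → ℕ → ℕ
incid x v = ind (x ≟ v)

incid-no : ∀ {x v} → x ≢ v → incid x v ≡ 0
incid-no {x} {v} x≢v = trans (ind≡𝟙 (x ≟ v)) (𝟙-no (x ≟ v) x≢v)

incid-shift : ∀ base i j → incid (base + i) (base + j) ≡ 𝟙 (i ≟ j)
incid-shift base i j =
  trans (ind≡𝟙 (base + i ≟ base + j))
        (𝟙-⇔ (base + i ≟ base + j) (i ≟ j) (+-cancelˡ-≡ base i j) (cong (base +_)))

incid-base : ∀ base j → incid base (base + j) ≡ 𝟙 (0 ≟ j)
incid-base base j =
  subst (λ b → incid b (base + j) ≡ 𝟙 (0 ≟ j)) (+-identityʳ base) (incid-shift base 0 j)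

-- Degree of v inside one cell: each corner equal to v lies on two edges.
cellDeg : Cell → ℕ → ℕ
cellDeg (a , b , c) v = 2 * (incid a v + incid b v + incid c v)

cellsDeg : List Cell → ℕ → ℕ
cellsDeg []       v = 0
cellsDeg (t ∷ ts) v = cellDeg t v + cellsDeg ts v

degree-cells : ∀ N cs v → degree (mkGr N cs) v ≡ cellsDeg cs v
degree-cells N []               v = refl
degree-cells N ((a , b , c) ∷ cs) v =
  trans (cong (λ r → (A + B) + ((B + C) + ((C + A) + r))) (degree-cells N cs v))
        (threeEdges A B C (cellsDeg cs v))
  where
  A B C : ℕ
  A = incid a v
  B = incid b v
  C = incid c v
  threeEdges : ∀ x y z r → (x + y) + ((y + z) + ((z + x) + r)) ≡ 2 * (x + y + z) + r
  threeEdges = solve-∀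

cellsDeg-++ : ∀ xs ys v → cellsDeg (xs ++ ys) v ≡ cellsDeg xs v + cellsDeg ys v
cellsDeg-++ []       ys v = refl
cellsDeg-++ (t ∷ ts) ys v =
  trans (cong (cellDeg t v +_) (cellsDeg-++ ts ys v)) (sym (+-assoc (cellDeg t v) _ _))

freshBlockDeg : ℕ → ℕ → ℕ
freshBlockDeg base v =
  4 * (incid base v + incid (base + 1) v + incid (base + 2) v) + 12 * incid (base + 3) v

subdivCell-deg : ∀ base t v →
  cellsDeg (subdivCell base t) v ≡ 2 * cellDeg t v + freshBlockDeg base v
subdivCell-deg base (a , b , c) v =
  sixCells (incid a v) (incid b v) (incid c v)
           (incid base v) (incid (base + 1) v) (incid (base + 2) v) (incid (base + 3) v)
  where
  sixCells : ∀ a b c u₁ u₂ u₃ o →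
    2 * (a + u₁ + o) + (2 * (u₁ + b + o) + (2 * (b + u₂ + o) + (2 * (u₂ + c + o)
      + (2 * (c + u₃ + o) + (2 * (u₃ + a + o) + 0)))))
    ≡ 2 * (2 * (a + b + c)) + (4 * (u₁ + u₂ + u₃) + 12 * o)
  sixCells = solve-∀

freshDeg : ℕ → ℕ → ℕ → ℕ
freshDeg base zero    v = 0
freshDeg base (suc L) v = freshBlockDeg base v + freshDeg (base + 4) L v

subdivAll-deg : ∀ base cs v →
  cellsDeg (subdivAll base cs) v ≡ 2 * cellsDeg cs v + freshDeg base (length cs) v
subdivAll-deg base []       v = refl
subdivAll-deg base (t ∷ ts) v = begin
  cellsDeg (subdivCell base t ++ subdivAll (base + 4) ts) v
    ≡⟨ cellsDeg-++ (subdivCell base t) (subdivAll (base + 4) ts) v ⟩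
  cellsDeg (subdivCell base t) v + cellsDeg (subdivAll (base + 4) ts) v
    ≡⟨ cong₂ _+_ (subdivCell-deg base t v) (subdivAll-deg (base + 4) ts v) ⟩
  (2 * cellDeg t v + freshBlockDeg base v) + (2 * cellsDeg ts v + freshDeg (base + 4) (length ts) v)
    ≡⟨ interleave (cellDeg t v) (freshBlockDeg base v) (cellsDeg ts v) _ ⟩
  2 * (cellDeg t v + cellsDeg ts v) + (freshBlockDeg base v + freshDeg (base + 4) (length ts) v) ∎
  where
  interleave : ∀ a b c d → (2 * a + b) + (2 * c + d) ≡ 2 * (a + c) + (b + d)
  interleave = solve-∀

freshBlock-outside : ∀ base v → (∀ i → i < 4 → base + i ≢ v) → freshBlockDeg base v ≡ 0
freshBlock-outside base v away
  rewrite incid-no {base} {v} (away 0 z<s ∘ trans (+-identityʳ base))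
        | incid-no {base + 1} {v} (away 1 (s<s z<s))
        | incid-no {base + 2} {v} (away 2 (s<s (s<s z<s)))
        | incid-no {base + 3} {v} (away 3 (s<s (s<s (s<s z<s)))) = refl

freshBlock-below : ∀ base v → v < base → freshBlockDeg base v ≡ 0
freshBlock-below base v v<base =
  freshBlock-outside base v (λ i _ → >⇒≢ (<-≤-trans v<base (m≤m+n base i)))

freshBlock-above : ∀ base v → base + 4 ≤ v → freshBlockDeg base v ≡ 0
freshBlock-above base v base+4≤v =
  freshBlock-outside base v (λ i i<4 → <⇒≢ (<-≤-trans (+-monoʳ-< base i<4) base+4≤v))

freshDeg-below : ∀ base L v → v < base → freshDeg base L v ≡ 0
freshDeg-below base zero    v _      = refl
freshDeg-below base (suc L) v v<base =
  cong₂ _+_ (freshBlock-below base v v<base)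
            (freshDeg-below (base + 4) L v (<-≤-trans v<base (m≤m+n base 4)))

freshDeg-above : ∀ base L v → base + L * 4 ≤ v → freshDeg base L v ≡ 0
freshDeg-above base zero    v _  = refl
freshDeg-above base (suc L) v le =
  cong₂ _+_ (freshBlock-above base v (m+n≤o⇒m≤o (base + 4) le′)) (freshDeg-above (base + 4) L v le′)
  where
  le′ : base + 4 + L * 4 ≤ v
  le′ = subst (_≤ v) (sym (+-assoc base 4 (L * 4))) le

-- In a block of fresh labels u_ab, u_bc, u_ca, o the centre o comes last, so
-- the fresh label at offset x is a centre iff x ≡ 3 (mod 4).
isCentre : ℕ → Bool
isCentre 0 = false
isCentre 1 = false
isCentre 2 = false
isCentre 3 = true
isCentre (suc (suc (suc (suc x)))) = isCentre x

freshVertexDeg : ℕ → ℕ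
freshVertexDeg x = if isCentre x then 12 else 4

freshBlock-at : ∀ base x → x < 4 → freshBlockDeg base (base + x) ≡ freshVertexDeg x
freshBlock-at base x x<4
  rewrite incid-base base x | incid-shift base 1 x | incid-shift base 2 x | incid-shift base 3 x
  = byOffset x x<4
  where
  byOffset : ∀ y → y < 4 →
    4 * (𝟙 (0 ≟ y) + 𝟙 (1 ≟ y) + 𝟙 (2 ≟ y)) + 12 * 𝟙 (3 ≟ y) ≡ freshVertexDeg y
  byOffset 0 _ = refl
  byOffset 1 _ = refl
  byOffset 2 _ = refl
  byOffset 3 _ = refl
  byOffset (suc (suc (suc (suc _)))) (s≤s (s≤s (s≤s (s≤s ()))))

freshDeg-firstBlock : ∀ base L x → x < 4 → freshDeg base (suc L) (base + x) ≡ freshVertexDeg x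
freshDeg-firstBlock base L x x<4 =
  trans (cong₂ _+_ (freshBlock-at base x x<4)
                   (freshDeg-below (base + 4) L (base + x) (+-monoʳ-< base x<4)))
        (+-identityʳ (freshVertexDeg x))

freshDeg-at : ∀ base L x → x < L * 4 → freshDeg base L (base + x) ≡ freshVertexDeg x
freshDeg-at base (suc L) 0 _ = freshDeg-firstBlock base L 0 z<s
freshDeg-at base (suc L) 1 _ = freshDeg-firstBlock base L 1 (s<s z<s)
freshDeg-at base (suc L) 2 _ = freshDeg-firstBlock base L 2 (s<s (s<s z<s))
freshDeg-at base (suc L) 3 _ = freshDeg-firstBlock base L 3 (s<s (s<s (s<s z<s)))
freshDeg-at base (suc L) (suc (suc (suc (suc y)))) (s≤s (s≤s (s≤s (s≤s y<L*4)))) = begin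
  freshBlockDeg base (base + (4 + y)) + freshDeg (base + 4) L (base + (4 + y))
    ≡⟨ cong₂ _+_ (freshBlock-above base (base + (4 + y)) (+-monoʳ-≤ base (m≤m+n 4 y)))
                 (cong (freshDeg (base + 4) L) (sym (+-assoc base 4 y))) ⟩
  freshDeg (base + 4) L (base + 4 + y)
    ≡⟨ freshDeg-at (base + 4) L y y<L*4 ⟩
  freshVertexDeg y ∎

liftClass : ∀ {n} → VClass n → VClass (suc n)
liftClass corner     = corner
liftClass (centre i) = centre (inject₁ i)
liftClass (mid i)    = mid (inject₁ i)

freshClass : ∀ n → ℕ → VClass (suc n)
freshClass n x = if isCentre x then centre (fromℕ n) else mid (fromℕ n)

classify : (n : ℕ) → ℕ → VClass n
classify zero    _ = corner
classify (suc n) v with v <? nV (V n)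
... | yes _ = liftClass (classify n v)
... | no  _ = freshClass n (v ∸ nV (V n))

classify-old : ∀ n v → v < nV (V n) → classify (suc n) v ≡ liftClass (classify n v)
classify-old n v v<N with v <? nV (V n)
... | yes _   = refl
... | no  v≮N = ⊥-elim (v≮N v<N)

classify-fresh : ∀ n x → classify (suc n) (nV (V n) + x) ≡ freshClass n x
classify-fresh n x with nV (V n) + x <? nV (V n)
... | yes N+x<N = ⊥-elim (m+n≮m (nV (V n)) x N+x<N)
... | no  _     = cong (freshClass n) (m+n∸m≡n (nV (V n)) x)

classDeg-lift : ∀ n y → classDeg (suc n) (liftClass y) ≡ 2 * classDeg n y
classDeg-lift n corner     = refl
classDeg-lift n (centre i)
  rewrite toℕ-inject₁ i | +-∸-assoc 1 (toℕ<n i) = threeTimesDouble (2 ^ (n ∸ suc (toℕ i) + 2))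
  where
  threeTimesDouble : ∀ d → 3 * (2 * d) ≡ 2 * (3 * d)
  threeTimesDouble = solve-∀
classDeg-lift n (mid i)
  rewrite toℕ-inject₁ i | +-∸-assoc 1 (toℕ<n i) = refl

freshClass-deg : ∀ n x → classDeg (suc n) (freshClass n x) ≡ freshVertexDeg x
freshClass-deg n x with isCentre x
... | true  rewrite toℕ-fromℕ n | n∸n≡0 n = refl
... | false rewrite toℕ-fromℕ n | n∸n≡0 n = refl

below-or-offset : ∀ N m v → v < N + m → v < N ⊎ Σ ℕ (λ x → v ≡ N + x × x < m)
below-or-offset N m v v<N+m with v <? N
... | yes v<N = inj₁ v<N
... | no  v≮N = inj₂ (v ∸ N , sym N+[v∸N]≡v
                    , +-cancelˡ-< N (v ∸ N) m (subst (_< N + m) (sym N+[v∸N]≡v) v<N+m))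
  where
  N+[v∸N]≡v : N + (v ∸ N) ≡ v
  N+[v∸N]≡v = m+[n∸m]≡n (≮⇒≥ v≮N)

DegreeInvariant : ℕ → Set
DegreeInvariant n =
  (∀ v → v < nV (V n) → cellsDeg (cells (V n)) v ≡ classDeg n (classify n v))
  × (∀ v → nV (V n) ≤ v → cellsDeg (cells (V n)) v ≡ 0)

module DegreeStep (n : ℕ) (invariant : DegreeInvariant n) where
  cs : List Cell
  cs = cells (V n)
  N L : ℕ
  N = nV (V n)
  L = length cs

  onVertices : ∀ v → v < N → cellsDeg cs v ≡ classDeg n (classify n v)
  onVertices = proj₁ invariant

  beyond : ∀ v → N ≤ v → cellsDeg cs v ≡ 0
  beyond = proj₂ invariant

  -- old vertices: degrees double, and so do the prescribed degrees
  old : ∀ v → v < N → cellsDeg (subdivAll N cs) v ≡ classDeg (suc n) (classify (suc n) v)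
  old v v<N = begin
    cellsDeg (subdivAll N cs) v                   ≡⟨ subdivAll-deg N cs v ⟩
    2 * cellsDeg cs v + freshDeg N L v
      ≡⟨ cong₂ (λ d f → 2 * d + f) (onVertices v v<N) (freshDeg-below N L v v<N) ⟩
    2 * classDeg n (classify n v) + 0             ≡⟨ +-identityʳ _ ⟩
    2 * classDeg n (classify n v)                 ≡⟨ sym (classDeg-lift n (classify n v)) ⟩
    classDeg (suc n) (liftClass (classify n v))   ≡⟨ cong (classDeg (suc n)) (sym (classify-old n v v<N)) ⟩
    classDeg (suc n) (classify (suc n) v)         ∎

  -- fresh vertices: only their own block contributes to their degree
  fresh : ∀ x → x < L * 4 →
    cellsDeg (subdivAll N cs) (N + x) ≡ classDeg (suc n) (classify (suc n) (N + x))
  fresh x x<L*4 = begin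
    cellsDeg (subdivAll N cs) (N + x)             ≡⟨ subdivAll-deg N cs (N + x) ⟩
    2 * cellsDeg cs (N + x) + freshDeg N L (N + x)
      ≡⟨ cong₂ (λ d f → 2 * d + f) (beyond (N + x) (m≤m+n N x)) (freshDeg-at N L x x<L*4) ⟩
    freshVertexDeg x                              ≡⟨ sym (freshClass-deg n x) ⟩
    classDeg (suc n) (freshClass n x)             ≡⟨ cong (classDeg (suc n)) (sym (classify-fresh n x)) ⟩
    classDeg (suc n) (classify (suc n) (N + x))   ∎

  onVertices′ : ∀ v → v < N + 4 * L →
    cellsDeg (subdivAll N cs) v ≡ classDeg (suc n) (classify (suc n) v)
  onVertices′ v v<N+4L with below-or-offset N (L * 4) v (subst (λ m → v < N + m) (*-comm 4 L) v<N+4L)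
  ... | inj₁ v<N                = old v v<N
  ... | inj₂ (x , refl , x<L*4) = fresh x x<L*4

  beyond′ : ∀ v → N + 4 * L ≤ v → cellsDeg (subdivAll N cs) v ≡ 0
  beyond′ v N+4L≤v = begin
    cellsDeg (subdivAll N cs) v                   ≡⟨ subdivAll-deg N cs v ⟩
    2 * cellsDeg cs v + freshDeg N L v
      ≡⟨ cong₂ (λ d f → 2 * d + f) (beyond v (m+n≤o⇒m≤o N N+4L≤v))
               (freshDeg-above N L v (subst (λ m → N + m ≤ v) (*-comm 4 L) N+4L≤v)) ⟩
    0                                             ∎

  next : DegreeInvariant (suc n)
  next = onVertices′ , beyond′

degreeInvariant : ∀ n → DegreeInvariant n
degreeInvariant zero    = onVertices , beyond
  where
  onVertices : ∀ v → v < 3 → cellsDeg ((0 , 1 , 2) ∷ []) v ≡ 2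
  onVertices 0 _ = refl
  onVertices 1 _ = refl
  onVertices 2 _ = refl
  onVertices (suc (suc (suc _))) (s≤s (s≤s (s≤s ())))
  beyond : ∀ v → 3 ≤ v → cellsDeg ((0 , 1 , 2) ∷ []) v ≡ 0
  beyond (suc (suc (suc _))) (s≤s (s≤s (s≤s _))) = refl
degreeInvariant (suc n) = DegreeStep.next n (degreeInvariant n)

countBelow : (ℕ → ℕ) → ℕ → ℕ
countBelow f zero    = 0
countBelow f (suc m) = f 0 + countBelow (f ∘ suc) m

countBelow-+ : ∀ f a m → countBelow f (a + m) ≡ countBelow f a + countBelow (λ x → f (a + x)) m
countBelow-+ f zero    m = refl
countBelow-+ f (suc a) m =
  trans (cong (f 0 +_) (countBelow-+ (f ∘ suc) a m)) (sym (+-assoc (f 0) _ _))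

countBelow-cong : ∀ m f g → (∀ x → x < m → f x ≡ g x) → countBelow f m ≡ countBelow g m
countBelow-cong zero    f g _  = refl
countBelow-cong (suc m) f g eq =
  cong₂ _+_ (eq 0 z<s) (countBelow-cong m (f ∘ suc) (g ∘ suc) (λ x x<m → eq (suc x) (s<s x<m)))

countBelow-zero : ∀ m → countBelow (λ _ → 0) m ≡ 0
countBelow-zero zero    = refl
countBelow-zero (suc m) = countBelow-zero m

countBelow-periodic : ∀ h → (∀ x → h (4 + x) ≡ h x) → ∀ L → countBelow h (L * 4) ≡ L * countBelow h 4
countBelow-periodic h period zero    = refl
countBelow-periodic h period (suc L) =
  trans (countBelow-+ h 4 (L * 4))
        (cong (countBelow h 4 +_)
              (trans (countBelow-cong (L * 4) _ h (λ x _ → period x)) (countBelow-periodic h period L)))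

length-filter-∷ : {A : Set} {P : A → Set} (P? : ∀ a → Dec (P a)) (a : A) (as : List A) →
  length (filter P? (a ∷ as)) ≡ 𝟙 (P? a) + length (filter P? as)
length-filter-∷ P? a as with P? a
... | yes _ = refl
... | no  _ = refl

length-filter-tabulate : {A : Set} {P : A → Set} (P? : ∀ a → Dec (P a)) →
  ∀ m (f : Fin m → A) (h : ℕ → ℕ) → (∀ i → 𝟙 (P? (f i)) ≡ h (toℕ i)) →
  length (filter P? (tabulate f)) ≡ countBelow h m
length-filter-tabulate P? zero    f h _  = refl
length-filter-tabulate P? (suc m) f h eq =
  trans (length-filter-∷ P? (f F.zero) (tabulate (f ∘ F.suc)))
        (cong₂ _+_ (eq F.zero) (length-filter-tabulate P? m (f ∘ F.suc) (h ∘ suc) (eq ∘ F.suc)))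

length-subdivAll : ∀ base cs → length (subdivAll base cs) ≡ length cs * 6
length-subdivAll base []       = refl
length-subdivAll base (t ∷ ts) = cong (6 +_) (length-subdivAll (base + 4) ts)

cellCount : ∀ n → length (cells (V n)) ≡ 6 ^ n
cellCount zero    = refl
cellCount (suc n) =
  trans (length-subdivAll (nV (V n)) (cells (V n)))
        (trans (cong (_* 6) (cellCount n)) (*-comm (6 ^ n) 6))

-- Each step adds 4 · 6^n vertices, so 5 · nV (V n) = 4 · 6^n + 11.
vertexCount×5 : ∀ n → nV (V n) * 5 ≡ 4 * 6 ^ n + 11
vertexCount×5 zero    = refl
vertexCount×5 (suc n) = begin
  (nV (V n) + 4 * length (cells (V n))) * 5 ≡⟨ cong (λ p → (nV (V n) + 4 * p) * 5) (cellCount n) ⟩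
  (nV (V n) + 4 * 6 ^ n) * 5                ≡⟨ expand (nV (V n)) (6 ^ n) ⟩
  nV (V n) * 5 + 20 * 6 ^ n                 ≡⟨ cong (_+ 20 * 6 ^ n) (vertexCount×5 n) ⟩
  4 * 6 ^ n + 11 + 20 * 6 ^ n               ≡⟨ collect (6 ^ n) ⟩
  4 * (6 * 6 ^ n) + 11                      ∎
  where
  expand : ∀ N p → (N + 4 * p) * 5 ≡ N * 5 + 20 * p
  expand = solve-∀
  collect : ∀ p → 4 * p + 11 + 20 * p ≡ 4 * (6 * p) + 11
  collect = solve-∀

vertexCount : ∀ n → nV (V n) ≡ (4 * 6 ^ n + 11) / 5
vertexCount n = sym (trans (cong (_/ 5) (sym (vertexCount×5 n))) (m*n/n≡m (nV (V n)) 5))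

data FinView : ∀ {n} → Fin (suc n) → Set where
  last  : ∀ {n} → FinView (fromℕ n)
  inner : ∀ {n} (j : Fin n) → FinView (inject₁ j)

finView : ∀ n (j : Fin (suc n)) → FinView j
finView zero    F.zero    = last
finView (suc n) F.zero    = inner F.zero
finView (suc n) (F.suc j) with finView n j
... | last    = last
... | inner k = inner (F.suc k)

data ClassView {n} : VClass (suc n) → Set where
  old       : (z : VClass n) → ClassView (liftClass z)
  newCentre : ClassView (centre (fromℕ n))
  newMid    : ClassView (mid (fromℕ n))

classView : ∀ n (c : VClass (suc n)) → ClassView c
classView n corner     = old corner
classView n (centre j) with finView n j
... | last    = newCentre
... | inner k = old (centre k)
classView n (mid j) with finView n j
... | last    = newMid
... | inner k = old (mid k)

centre-injective : ∀ {n} {i j : Fin n} → centre i ≡ centre j → i ≡ j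
centre-injective refl = refl

mid-injective : ∀ {n} {i j : Fin n} → mid i ≡ mid j → i ≡ j
mid-injective refl = refl

liftClass-injective : ∀ {n} (y z : VClass n) → liftClass y ≡ liftClass z → y ≡ z
liftClass-injective corner     corner     _    = refl
liftClass-injective (centre i) (centre j) eq   = cong centre (inject₁-injective (centre-injective eq))
liftClass-injective (mid i)    (mid j)    eq   = cong mid (inject₁-injective (mid-injective eq))
liftClass-injective corner     (centre _) ()
liftClass-injective corner     (mid _)    ()
liftClass-injective (centre _) corner     ()
liftClass-injective (centre _) (mid _)    ()
liftClass-injective (mid _)    corner     ()
liftClass-injective (mid _)    (centre _) ()

liftClass≢newCentre : ∀ n (y : VClass n) → centre (fromℕ n) ≢ liftClass y
liftClass≢newCentre n corner     ()
liftClass≢newCentre n (centre i) eq = fromℕ≢inject₁ (centre-injective eq)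
liftClass≢newCentre n (mid i)    ()

liftClass≢newMid : ∀ n (y : VClass n) → mid (fromℕ n) ≢ liftClass y
liftClass≢newMid n corner     ()
liftClass≢newMid n (centre i) ()
liftClass≢newMid n (mid i)    eq = fromℕ≢inject₁ (mid-injective eq)

size-lift : ∀ n (z : VClass n) → classSize (suc n) (liftClass z) ≡ classSize n z
size-lift n corner     = refl
size-lift n (centre i) rewrite toℕ-inject₁ i = refl
size-lift n (mid i)    rewrite toℕ-inject₁ i = refl

-- Counting class c in V_{n+1}: old vertices with lifted class equal to c,
-- plus one block of four fresh labels per cell of V_n.
count-step : ∀ n c →
  countBelow (λ v → 𝟙 (classify (suc n) v ≟C c)) (nV (V (suc n)))
  ≡ countBelow (λ v → 𝟙 (liftClass (classify n v) ≟C c)) (nV (V n))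
    + length (cells (V n)) * countBelow (λ x → 𝟙 (freshClass n x ≟C c)) 4
count-step n c = begin
  countBelow f (N + 4 * L)                     ≡⟨ cong (λ m → countBelow f (N + m)) (*-comm 4 L) ⟩
  countBelow f (N + L * 4)                     ≡⟨ countBelow-+ f N (L * 4) ⟩
  countBelow f N + countBelow (λ x → f (N + x)) (L * 4)
    ≡⟨ cong₂ _+_ (countBelow-cong N f _ (λ v v<N → cong (λ z → 𝟙 (z ≟C c)) (classify-old n v v<N)))
                 (countBelow-cong (L * 4) _ _ (λ x _ → cong (λ z → 𝟙 (z ≟C c)) (classify-fresh n x))) ⟩
  countBelow (λ v → 𝟙 (liftClass (classify n v) ≟C c)) N
    + countBelow (λ x → 𝟙 (freshClass n x ≟C c)) (L * 4)
    ≡⟨ cong (countBelow (λ v → 𝟙 (liftClass (classify n v) ≟C c)) N +_)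
            (countBelow-periodic (λ x → 𝟙 (freshClass n x ≟C c)) (λ _ → refl) L) ⟩
  countBelow (λ v → 𝟙 (liftClass (classify n v) ≟C c)) N
    + L * countBelow (λ x → 𝟙 (freshClass n x ≟C c)) 4 ∎
  where
  N L : ℕ
  N = nV (V n)
  L = length (cells (V n))
  f : ℕ → ℕ
  f v = 𝟙 (classify (suc n) v ≟C c)

count-classes : ∀ n c → countBelow (λ v → 𝟙 (classify n v ≟C c)) (nV (V n)) ≡ classSize n c
count-classes zero    corner = refl
count-classes (suc n) c      = trans (count-step n c) (byView (classView n c))
  where
  N L : ℕ
  N = nV (V n)
  L = length (cells (V n))
  noLift : ∀ c′ → (∀ y → c′ ≢ liftClass y) → countBelow (λ v → 𝟙 (liftClass (classify n v) ≟C c′)) N ≡ 0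
  noLift c′ new = trans (countBelow-cong N _ _ (λ v _ → 𝟙-no (_ ≟C c′) (new (classify n v) ∘ sym)))
                        (countBelow-zero N)
  byView : ∀ {c} → ClassView c →
    countBelow (λ v → 𝟙 (liftClass (classify n v) ≟C c)) N
      + L * countBelow (λ x → 𝟙 (freshClass n x ≟C c)) 4 ≡ classSize (suc n) c
  byView (old z)
    rewrite 𝟙-no (mid (fromℕ n) ≟C liftClass z) (liftClass≢newMid n z)
          | 𝟙-no (centre (fromℕ n) ≟C liftClass z) (liftClass≢newCentre n z)
          | countBelow-cong N (λ v → 𝟙 (liftClass (classify n v) ≟C liftClass z)) (λ v → 𝟙 (classify n v ≟C z))
              (λ v _ → 𝟙-⇔ (_ ≟C _) (_ ≟C _) (liftClass-injective _ z) (cong liftClass))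
          | count-classes n z | *-zeroʳ L | size-lift n z = +-identityʳ (classSize n z)
  byView newCentre
    rewrite noLift (centre (fromℕ n)) (liftClass≢newCentre n)
          | 𝟙-yes (centre (fromℕ n) ≟C centre (fromℕ n)) refl
          | cellCount n | toℕ-fromℕ n = *-identityʳ (6 ^ n)
  byView newMid
    rewrite noLift (mid (fromℕ n)) (liftClass≢newMid n)
          | 𝟙-yes (mid (fromℕ n) ≟C mid (fromℕ n)) refl
          | cellCount n | toℕ-fromℕ n = *-comm (6 ^ n) 3

lemma5p4 : (n : ℕ) →
    (nV (V n) ≡ (4 * 6 ^ n + 11) / 5)
    × Σ (Fin (nV (V n)) → VClass n) (λ cls →
        ((v : Fin (nV (V n))) → degree (V n) (toℕ v) ≡ classDeg n (cls v))
        × ((c : VClass n) → classCount (V n) cls c ≡ classSize n c))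
lemma5p4 n = vertexCount n , cls , degrees , sizes
  where
  cls : Fin (nV (V n)) → VClass n
  cls v = classify n (toℕ v)
  degrees : (v : Fin (nV (V n))) → degree (V n) (toℕ v) ≡ classDeg n (cls v)
  degrees v = trans (degree-cells (nV (V n)) (cells (V n)) (toℕ v))
                    (proj₁ (degreeInvariant n) (toℕ v) (toℕ<n v))
  sizes : (c : VClass n) → classCount (V n) cls c ≡ classSize n c
  sizes c = trans (length-filter-tabulate (λ v → cls v ≟C c) (nV (V n)) (λ v → v)
                                          (λ x → 𝟙 (classify n x ≟C c)) (λ _ → refl))
                  (count-classes n c)
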